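{- Let $G$ be a simple graph on $n$ vertices with adjacency matrix $A$ and walk-matrix $W=[e,Ae,\dots,A^{n-1}e]$ ($e$ the all-one vector), and let $p$ be a prime with $\mathrm{rank}_p(W)=n-1$. Then for every integer $\lambda_0$, $\mathrm{rank}_p(A-\lambda_0 I)\geq n-2$.
   Context: $\mathrm{rank}_p(M)$ denotes the rank of an integral matrix $M$ over $\mathbf{F}_p$. -}

module Defs where

open import Data.Nat using (ℕ; zero; suc)
open import Data.Integer using (ℤ; +_; _+_; _*_; _-_; 0ℤ; 1ℤ)
open import Data.Integer.Divisibility using (_∣_)
open import Data.Fin using (Fin; zero; suc; toℕ; _≟_)
open import Data.Bool using (Bool; true; false; if_then_else_)
open import Data.Product using (Σ; _×_; ∃-syntax)
open import Relation.Nullary using (¬_; does)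
open import Relation.Binary.PropositionalEquality using (_≡_)
open import Function.Definitions using (Injective)

Matrix : ℕ → ℕ → Set
Matrix m k = Fin m → Fin k → ℤ

sumFin : (k : ℕ) → (Fin k → ℤ) → ℤ
sumFin zero    f = 0ℤ
sumFin (suc k) f = f zero + sumFin k (λ j → f (suc j))

record SimpleGraph (n : ℕ) : Set where
  field
    adj    : Fin n → Fin n → Bool
    sym    : ∀ i j → adj i j ≡ adj j i
    irrefl : ∀ i → adj i i ≡ false

adjMatrix : ∀ {n} → SimpleGraph n → Matrix n n
adjMatrix G i j = if SimpleGraph.adj G i j then 1ℤ else 0ℤ

mulVec : ∀ {m k} → Matrix m k → (Fin k → ℤ) → (Fin m → ℤ)
mulVec {k = k} M v i = sumFin k (λ j → M i j * v j)

walkVec : ∀ {n} → Matrix n n → ℕ → (Fin n → ℤ)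
walkVec A zero    = λ _ → 1ℤ
walkVec A (suc t) = mulVec A (walkVec A t)

walkMatrix : ∀ {n} → Matrix n n → Matrix n n
walkMatrix A i j = walkVec A (toℕ j) i

shiftMatrix : ∀ {n} → Matrix n n → ℤ → Matrix n n
shiftMatrix A λ₀ i j = A i j - (if does (i ≟ j) then λ₀ else 0ℤ)

-- The columns f 0, …, f (r-1) of M are linearly independent over F_p:
-- every integer combination that vanishes mod p has all coefficients ≡ 0 mod p.
ColsIndepMod : ∀ {m k} → ℕ → Matrix m k → (r : ℕ) → (Fin r → Fin k) → Set
ColsIndepMod {m} p M r f =
  (x : Fin r → ℤ) →
  (∀ i → (+ p) ∣ sumFin r (λ j → x j * M i (f j))) →
  ∀ j → (+ p) ∣ x j

-- rank_p(M) ≥ r : M has r distinct columns linearly independent over F_p.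
RankGe : ∀ {m k} → ℕ → Matrix m k → ℕ → Set
RankGe {k = k} p M r =
  Σ (Fin r → Fin k) λ f → Injective _≡_ _≡_ f × ColsIndepMod p M r f

RankEq : ∀ {m k} → ℕ → Matrix m k → ℕ → Set
RankEq p M r = RankGe p M r × ¬ RankGe p M (suc r)

-- The vectors e and (A - λ₀I)Aᵗe (t < n - 1) span every walk vector Aᵗe with t ≤ n - 1, because
-- Aᵗ⁺¹e = λ₀Aᵗe + (A - λ₀I)Aᵗe. By the Steinitz exchange lemma over F_p, n - 1 of these n generators
-- are independent; dropping e if it is among them leaves n - 2 independent vectors in the column
-- space of A - λ₀I, and a second exchange turns them into n - 2 independent columns of A - λ₀I.

module Submission where

open import Defs
open import Data.Nat using (ℕ; zero; suc; _∸_; _≤_)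
open import Data.Nat.Properties using (<⇒≤)
open import Data.Nat.Primality using (Prime; euclidsLemma; ¬prime[1])
open import Data.Nat.Divisibility using (∣1⇒≡1) renaming (_∣_ to _∣ℕ_)
open import Data.Integer using (ℤ; +_; _+_; _*_; _-_; -_; 0ℤ; 1ℤ; ∣_∣)
import Data.Integer.Properties as ℤ
open import Data.Integer.Divisibility.Signed
  using (_∣_; divides; _∣?_; ∣ᵤ⇒∣; ∣⇒∣ᵤ; ∣m∣n⇒∣m+n; ∣m∣n⇒∣m-n; ∣m+n∣n⇒∣m; ∣n⇒∣m*n; ∣m⇒∣m*n)
open import Data.Integer.Tactic.RingSolver using (solve-∀)
open import Data.Fin using (Fin; zero; suc; toℕ; fromℕ<; punchIn; _≟_)
open import Data.Fin.Properties
  using (toℕ≤pred[n]; toℕ-fromℕ<; punchIn-injective; punchInᵢ≢i; all?; any?; ¬∀⟶∃¬)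
open import Data.Vec.Functional using (_∷_; tail; removeAt; insertAt)
open import Data.Vec.Functional.Properties using (insertAt-lookup; insertAt-punchIn)
open import Data.Bool using (if_then_else_)
open import Data.Product using (Σ; _×_; _,_)
open import Data.Sum using (inj₁; inj₂)
open import Data.Empty using (⊥-elim)
open import Function using (_∘_)
open import Function.Definitions using (Injective)
open import Relation.Nullary using (¬_; Dec; does; yes; no)
open import Relation.Binary.PropositionalEquality
  using (_≡_; _≢_; refl; sym; trans; cong; cong₂; subst; module ≡-Reasoning)

sumFin-cong : ∀ k {f g : Fin k → ℤ} → (∀ j → f j ≡ g j) → sumFin k f ≡ sumFin k g
sumFin-cong zero    f≡g = refl
sumFin-cong (suc k) f≡g = cong₂ _+_ (f≡g zero) (sumFin-cong k (f≡g ∘ suc))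

sumFin-*ˡ : ∀ k a (f : Fin k → ℤ) → sumFin k (λ j → a * f j) ≡ a * sumFin k f
sumFin-*ˡ zero    a f = sym (ℤ.*-zeroʳ a)
sumFin-*ˡ (suc k) a f =
  trans (cong (_+_ (a * f zero)) (sumFin-*ˡ k a (f ∘ suc))) (sym (ℤ.*-distribˡ-+ a (f zero) _))

sumFin-linear : ∀ k a b (f g : Fin k → ℤ) →
                sumFin k (λ j → a * f j + b * g j) ≡ a * sumFin k f + b * sumFin k g
sumFin-linear zero    a b f g = sym (annihilate a b)
  where
  annihilate : ∀ a b → a * 0ℤ + b * 0ℤ ≡ 0ℤ
  annihilate = solve-∀
sumFin-linear (suc k) a b f g =
  trans (cong (_+_ (a * f zero + b * g zero)) (sumFin-linear k a b (f ∘ suc) (g ∘ suc)))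
        (regroup a b (f zero) (g zero) _ _)
  where
  regroup : ∀ a b x y X Y → (a * x + b * y) + (a * X + b * Y) ≡ a * (x + X) + b * (y + Y)
  regroup = solve-∀

sumFin-punchIn : ∀ {r} (j : Fin (suc r)) (f : Fin (suc r) → ℤ) →
                 sumFin (suc r) f ≡ f j + sumFin r (f ∘ punchIn j)
sumFin-punchIn          zero    f = refl
sumFin-punchIn {suc r} (suc j) f =
  trans (cong (_+_ (f zero)) (sumFin-punchIn j (f ∘ suc))) (swap (f zero) (f (suc j)) _)
  where
  swap : ∀ a b c → a + (b + c) ≡ b + (a + c)
  swap = solve-∀

sumFin-diagonal : ∀ {n} (i : Fin n) (d : ℤ) (g : Fin n → ℤ) →
                  sumFin n (λ j → (if does (i ≟ j) then d else 0ℤ) * g j) ≡ d * g i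
sumFin-diagonal {suc n} zero    d g =
  trans (cong (_+_ (d * g zero)) (trans (sumFin-*ˡ n 0ℤ (g ∘ suc)) (ℤ.*-zeroˡ (sumFin n (g ∘ suc)))))
        (ℤ.+-identityʳ (d * g zero))
sumFin-diagonal {suc n} (suc i) d g =
  trans (cong₂ _+_ (ℤ.*-zeroˡ (g zero)) (sumFin-diagonal i d (g ∘ suc))) (ℤ.+-identityˡ _)

-- Finite families of integer vectors, u t i being coordinate i of the t-th vector.

lincomb : ∀ {m r} → (Fin r → ℤ) → (Fin r → Fin m → ℤ) → Fin m → ℤ
lincomb {r = r} x u i = sumFin r (λ t → x t * u t i)

column : ∀ {m k} → Matrix m k → Fin k → Fin m → ℤ
column M j i = M i j

moveToFront : ∀ {a} {A : Set a} {n} → (Fin (suc n) → A) → Fin (suc n) → Fin (suc n) → A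
moveToFront u j = u j ∷ removeAt u j

-- One step of Gaussian elimination: v zero is the pivot row, coordinate zero the pivot column.
eliminate : ∀ {m r} → (Fin (suc r) → Fin (suc m) → ℤ) → Fin r → Fin (suc m) → ℤ
eliminate v t i = v zero zero * v (suc t) i - v (suc t) zero * v zero i

lincomb-congˡ : ∀ {m r} {x y : Fin r → ℤ} (u : Fin r → Fin m → ℤ) →
                (∀ t → x t ≡ y t) → ∀ i → lincomb x u i ≡ lincomb y u i
lincomb-congˡ {r = r} u x≡y i = sumFin-cong r (λ t → cong (_* u t i) (x≡y t))

lincomb-moveToFront : ∀ {m r} (j : Fin (suc r)) (x : Fin (suc r) → ℤ) (u : Fin (suc r) → Fin m → ℤ) →
                      ∀ i → lincomb x u i ≡ lincomb (moveToFront x j) (moveToFront u j) i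
lincomb-moveToFront j x u i = sumFin-punchIn j (λ t → x t * u t i)

lincomb-scaleˡ : ∀ {m r} a (x : Fin r → ℤ) (u : Fin r → Fin m → ℤ) →
                 ∀ i → lincomb (λ t → a * x t) u i ≡ a * lincomb x u i
lincomb-scaleˡ {r = r} a x u i =
  trans (sumFin-cong r (λ t → ℤ.*-assoc a (x t) (u t i))) (sumFin-*ˡ r a (λ t → x t * u t i))

lincomb-scaleʳ : ∀ {m r} a (x : Fin r → ℤ) (u : Fin r → Fin m → ℤ) →
                 ∀ i → lincomb x (λ t j → a * u t j) i ≡ a * lincomb x u i
lincomb-scaleʳ {r = r} a x u i =
  trans (sumFin-cong r (λ t → commute (x t) a (u t i))) (sumFin-*ˡ r a (λ t → x t * u t i))
  where
  commute : ∀ x a u → x * (a * u) ≡ a * (x * u)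
  commute = solve-∀

lincomb-linearˡ : ∀ {m k} a b (y z : Fin k → ℤ) (c : Fin k → Fin m → ℤ) →
                  ∀ i → lincomb (λ l → a * y l - b * z l) c i ≡ a * lincomb y c i - b * lincomb z c i
lincomb-linearˡ {k = k} a b y z c i = begin
  sumFin k (λ l → (a * y l - b * z l) * c l i)
    ≡⟨ sumFin-cong k (λ l → expand a b (y l) (z l) (c l i)) ⟩
  sumFin k (λ l → a * (y l * c l i) + (- b) * (z l * c l i))
    ≡⟨ sumFin-linear k a (- b) (λ l → y l * c l i) (λ l → z l * c l i) ⟩
  a * lincomb y c i + (- b) * lincomb z c i
    ≡⟨ cong (_+_ (a * lincomb y c i)) (sym (ℤ.neg-distribˡ-* b _)) ⟩
  a * lincomb y c i - b * lincomb z c i ∎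
  where
  open ≡-Reasoning
  expand : ∀ a b y z c → (a * y - b * z) * c ≡ a * (y * c) + (- b) * (z * c)
  expand = solve-∀

lincomb-eliminate : ∀ {m r} (x : Fin r → ℤ) (v : Fin (suc r) → Fin (suc m) → ℤ) → ∀ i →
                    lincomb x (eliminate v) i
                    ≡ v zero zero * lincomb x (tail v) i - lincomb x (tail v) zero * v zero i
lincomb-eliminate {r = r} x v i = begin
  sumFin r (λ t → x t * (b * v (suc t) i - v (suc t) zero * v zero i))
    ≡⟨ sumFin-cong r (λ t → expand (x t) b (v (suc t) i) (v (suc t) zero) (v zero i)) ⟩
  sumFin r (λ t → b * (x t * v (suc t) i) + (- v zero i) * (x t * v (suc t) zero))
    ≡⟨ sumFin-linear r b (- v zero i) (λ t → x t * v (suc t) i) (λ t → x t * v (suc t) zero) ⟩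
  b * lincomb x (tail v) i + (- v zero i) * lincomb x (tail v) zero
    ≡⟨ collect b (lincomb x (tail v) i) (v zero i) (lincomb x (tail v) zero) ⟩
  b * lincomb x (tail v) i - lincomb x (tail v) zero * v zero i ∎
  where
  open ≡-Reasoning
  b = v zero zero
  expand : ∀ x b u α w → x * (b * u - α * w) ≡ b * (x * u) + (- w) * (x * α)
  expand = solve-∀
  collect : ∀ b L w S → b * L + (- w) * S ≡ b * L - S * w
  collect = solve-∀

lincomb-tail-eliminate : ∀ {m r} (x : Fin (suc r) → ℤ) (v : Fin (suc r) → Fin (suc m) → ℤ) → ∀ i →
                         lincomb (tail x) (eliminate v) i
                         ≡ v zero zero * lincomb x v i - lincomb x v zero * v zero i
lincomb-tail-eliminate x v i =
  trans (lincomb-eliminate (tail x) v i)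
        (reassociate (v zero zero) (x zero) (v zero i)
                     (lincomb (tail x) (tail v) i) (lincomb (tail x) (tail v) zero))
  where
  reassociate : ∀ b x₀ w L S → b * L - S * w ≡ b * (x₀ * w + L) - (x₀ * b + S) * w
  reassociate = solve-∀

avoid-zero : ∀ {r k} (g : Fin (suc r) → Fin (suc k)) → Injective _≡_ _≡_ g →
             Σ (Fin (suc r)) λ i → ∀ t → g (punchIn i t) ≢ zero
avoid-zero g g-injective with any? (λ i → g i ≟ zero)
... | yes (i , gi≡0) = i , λ t eq → punchInᵢ≢i i t (g-injective (trans eq (sym gi≡0)))
... | no ∄i          = zero , λ t eq → ∄i (punchIn zero t , eq)

module _ (p : ℕ) (p-prime : Prime p) where

  -- F_p is modelled by ℤ, with x ≡0 meaning x ≡ 0 (mod p).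
  infix 4 _≡0
  _≡0 : ℤ → Set
  x ≡0 = + p ∣ x

  _≡0? : ∀ x → Dec (x ≡0)
  x ≡0? = + p ∣? x

  0≡0 : 0ℤ ≡0
  0≡0 = divides 0ℤ refl

  ¬1≡0 : ¬ 1ℤ ≡0
  ¬1≡0 p∣1 = ¬prime[1] (subst Prime (∣1⇒≡1 (∣⇒∣ᵤ p∣1)) p-prime)

  ≡0-cancelˡ : ∀ {a b} → ¬ a ≡0 → a * b ≡0 → b ≡0
  ≡0-cancelˡ {a} {b} a≢0 ab≡0
    with euclidsLemma ∣ a ∣ ∣ b ∣ p-prime (subst (p ∣ℕ_) (ℤ.abs-* a b) (∣⇒∣ᵤ ab≡0))
  ... | inj₁ p∣a = ⊥-elim (a≢0 (∣ᵤ⇒∣ p∣a))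
  ... | inj₂ p∣b = ∣ᵤ⇒∣ p∣b

  ≡0-sumFin : ∀ k {f : Fin k → ℤ} → (∀ j → f j ≡0) → sumFin k f ≡0
  ≡0-sumFin zero    _    = 0≡0
  ≡0-sumFin (suc k) f≡0 = ∣m∣n⇒∣m+n (f≡0 zero) (≡0-sumFin k (f≡0 ∘ suc))

  Independent : ∀ {m r} → (Fin r → Fin m → ℤ) → Set
  Independent {r = r} u = ∀ x → (∀ i → lincomb x u i ≡0) → ∀ t → x t ≡0

  record InSpan {m k} (c : Fin k → Fin m → ℤ) (v : Fin m → ℤ) : Set where
    constructor ⟨_,_⟩
    field
      coefficients : Fin k → ℤ
      residual≡0   : ∀ i → v i - lincomb coefficients c i ≡0

  colsIndepMod⇒independent : ∀ {m k r} (M : Matrix m k) (f : Fin r → Fin k) →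
                             ColsIndepMod p M r f → Independent (column M ∘ f)
  colsIndepMod⇒independent M f indep x comb≡0 t = ∣ᵤ⇒∣ (indep x (∣⇒∣ᵤ ∘ comb≡0) t)

  independent⇒colsIndepMod : ∀ {m k r} (M : Matrix m k) (f : Fin r → Fin k) →
                             Independent (column M ∘ f) → ColsIndepMod p M r f
  independent⇒colsIndepMod M f indep x comb≡0 t = ∣⇒∣ᵤ (indep x (∣ᵤ⇒∣ ∘ comb≡0) t)

  independent-∘tail⁻¹ : ∀ {m r} (u : Fin r → Fin (suc m) → ℤ) → Independent (tail ∘ u) → Independent u
  independent-∘tail⁻¹ u indep x comb≡0 = indep x (comb≡0 ∘ suc)

  independent-∘tail : ∀ {m r} (u : Fin r → Fin (suc m) → ℤ) →
                      (∀ t → u t zero ≡0) → Independent u → Independent (tail ∘ u)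
  independent-∘tail {r = r} u u₀≡0 indep x comb≡0 = indep x λ
    { zero    → ≡0-sumFin r (λ t → ∣n⇒∣m*n (x t) (u₀≡0 t))
    ; (suc i) → comb≡0 i
    }

  independent-tail : ∀ {m r} (u : Fin (suc r) → Fin m → ℤ) → Independent u → Independent (tail u)
  independent-tail u indep x comb≡0 t = indep (0ℤ ∷ x) padded≡0 (suc t)
    where
    padded≡0 : ∀ i → lincomb (0ℤ ∷ x) u i ≡0
    padded≡0 i = subst _≡0 (sym drop-zero) (comb≡0 i)
      where
      drop-zero : 0ℤ * u zero i + lincomb x (tail u) i ≡ lincomb x (tail u) i
      drop-zero = trans (cong (λ s → s + lincomb x (tail u) i) (ℤ.*-zeroˡ (u zero i))) (ℤ.+-identityˡ _)

  independent-moveToFront : ∀ {m r} (u : Fin (suc r) → Fin m → ℤ) (j : Fin (suc r)) →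
                            Independent u → Independent (moveToFront u j)
  independent-moveToFront u j indep x comb≡0 = x≡0
    where
    X = insertAt (tail x) j (x zero)
    X-moved : ∀ t → moveToFront X j t ≡ x t
    X-moved zero    = insertAt-lookup (tail x) j (x zero)
    X-moved (suc t) = insertAt-punchIn (tail x) j (x zero) t
    X≡0 : ∀ t → X t ≡0
    X≡0 = indep X λ i →
      subst _≡0 (sym (trans (lincomb-moveToFront j X u i) (lincomb-congˡ (moveToFront u j) X-moved i)))
            (comb≡0 i)
    x≡0 : ∀ t → x t ≡0
    x≡0 zero    = subst _≡0 (X-moved zero) (X≡0 j)
    x≡0 (suc t) = subst _≡0 (X-moved (suc t)) (X≡0 (punchIn j t))

  independent-removeAt : ∀ {m r} (u : Fin (suc r) → Fin m → ℤ) (j : Fin (suc r)) →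
                         Independent u → Independent (removeAt u j)
  independent-removeAt u j = independent-tail (moveToFront u j) ∘ independent-moveToFront u j

  independent-scale : ∀ {m r} {a} (u : Fin r → Fin m → ℤ) → ¬ a ≡0 →
                      Independent u → Independent (λ t i → a * u t i)
  independent-scale {a = a} u a≢0 indep x comb≡0 =
    indep x (λ i → ≡0-cancelˡ a≢0 (subst _≡0 (lincomb-scaleʳ a x u i) (comb≡0 i)))

  eliminate-zero : ∀ {m r} (v : Fin (suc r) → Fin (suc m) → ℤ) t → eliminate v t zero ≡0
  eliminate-zero v t = subst _≡0 (sym cancel) 0≡0
    where
    cancel : v zero zero * v (suc t) zero - v (suc t) zero * v zero zero ≡ 0ℤ
    cancel = trans (cong (_-_ (v zero zero * v (suc t) zero)) (ℤ.*-comm (v (suc t) zero) (v zero zero)))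
                   (ℤ.+-inverseʳ (v zero zero * v (suc t) zero))

  -- A combination x of the eliminated vectors is the combination (- S) ∷ (b · x) of v itself.
  independent-eliminate : ∀ {m r} (v : Fin (suc r) → Fin (suc m) → ℤ) → ¬ v zero zero ≡0 →
                          Independent v → Independent (tail ∘ eliminate v)
  independent-eliminate {r = r} v b≢0 indep =
    independent-∘tail (eliminate v) (eliminate-zero v) λ x comb≡0 t →
      ≡0-cancelˡ b≢0 (indep (X x) (λ i → subst _≡0 (sym (lincomb-X x i)) (comb≡0 i)) (suc t))
    where
    b = v zero zero
    X : (Fin r → ℤ) → Fin (suc r) → ℤ
    X x = (- lincomb x (tail v) zero) ∷ (λ t → b * x t)
    lincomb-X : ∀ x i → lincomb (X x) v i ≡ lincomb x (eliminate v) i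
    lincomb-X x i = begin
      (- S) * v zero i + lincomb (λ t → b * x t) (tail v) i
        ≡⟨ cong (_+_ ((- S) * v zero i)) (lincomb-scaleˡ b x (tail v) i) ⟩
      (- S) * v zero i + b * lincomb x (tail v) i
        ≡⟨ rearrange S (v zero i) b (lincomb x (tail v) i) ⟩
      b * lincomb x (tail v) i - S * v zero i
        ≡⟨ sym (lincomb-eliminate x v i) ⟩
      lincomb x (eliminate v) i ∎
      where
      open ≡-Reasoning
      S = lincomb x (tail v) zero
      rearrange : ∀ S w b L → (- S) * w + b * L ≡ b * L - S * w
      rearrange = solve-∀

  independent-eliminate⁻¹ : ∀ {m r} (v : Fin (suc r) → Fin (suc m) → ℤ) → ¬ v zero zero ≡0 →
                            Independent (tail ∘ eliminate v) → Independent v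
  independent-eliminate⁻¹ {r = r} v b≢0 indep x comb≡0 = x≡0
    where
    tail-x≡0 : ∀ t → x (suc t) ≡0
    tail-x≡0 = indep (tail x) λ i →
      subst _≡0 (sym (lincomb-tail-eliminate x v (suc i)))
            (∣m∣n⇒∣m-n (∣n⇒∣m*n (v zero zero) (comb≡0 (suc i))) (∣m⇒∣m*n (v zero (suc i)) (comb≡0 zero)))
    x₀b≡0 : x zero * v zero zero ≡0
    x₀b≡0 = ∣m+n∣n⇒∣m (comb≡0 zero) (≡0-sumFin r (λ t → ∣m⇒∣m*n (v (suc t) zero) (tail-x≡0 t)))
    x≡0 : ∀ t → x t ≡0
    x≡0 zero    = ≡0-cancelˡ b≢0 (subst _≡0 (ℤ.*-comm (x zero) _) x₀b≡0)
    x≡0 (suc t) = tail-x≡0 t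

  span-cong : ∀ {m k} {c : Fin k → Fin m → ℤ} {v w : Fin m → ℤ} →
              (∀ i → v i ≡ w i) → InSpan c v → InSpan c w
  span-cong v≡w ⟨ y , v-comb≡0 ⟩ = ⟨ y , (λ i → subst (λ s → s - _ ≡0) (v≡w i) (v-comb≡0 i)) ⟩

  span-exact : ∀ {m k} {c : Fin k → Fin m → ℤ} {v : Fin m → ℤ} (y : Fin k → ℤ) →
               (∀ i → lincomb y c i ≡ v i) → InSpan c v
  span-exact {v = v} y comb≡v =
    ⟨ y , (λ i → subst _≡0 (sym (trans (cong (_-_ (v i)) (comb≡v i)) (ℤ.+-inverseʳ (v i)))) 0≡0) ⟩

  span-generator : ∀ {m k} (c : Fin k → Fin m → ℤ) (l : Fin k) → InSpan c (c l)
  span-generator c l = span-exact (λ j → if does (l ≟ j) then 1ℤ else 0ℤ) λ i →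
    trans (sumFin-diagonal l 1ℤ (λ j → c j i)) (ℤ.*-identityˡ (c l i))

  span-linear : ∀ {m k} {c : Fin k → Fin m → ℤ} {v w : Fin m → ℤ} (a b : ℤ) →
                InSpan c v → InSpan c w → InSpan c (λ i → a * v i - b * w i)
  span-linear {c = c} {v} {w} a b ⟨ y , v-comb≡0 ⟩ ⟨ z , w-comb≡0 ⟩ =
    ⟨ (λ l → a * y l - b * z l) , (λ i →
      subst _≡0 (sym (trans (cong (_-_ (a * v i - b * w i)) (lincomb-linearˡ a b y z c i))
                            (distribute a (v i) (lincomb y c i) b (w i) (lincomb z c i))))
            (∣m∣n⇒∣m-n (∣n⇒∣m*n a (v-comb≡0 i)) (∣n⇒∣m*n b (w-comb≡0 i)))) ⟩
    where
    distribute : ∀ a v Y b w Z → (a * v - b * w) - (a * Y - b * Z) ≡ a * (v - Y) - b * (w - Z)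
    distribute = solve-∀

  span-coordinate : ∀ {m k} {c : Fin k → Fin m → ℤ} {v : Fin m → ℤ} (i : Fin m) →
                    (∀ l → c l i ≡0) → InSpan c v → v i ≡0
  span-coordinate {k = k} {c} {v} i cᵢ≡0 ⟨ y , v-comb≡0 ⟩ =
    subst _≡0 (cancel (v i) (lincomb y c i))
          (∣m∣n⇒∣m+n (v-comb≡0 i) (≡0-sumFin k (λ l → ∣n⇒∣m*n (y l) (cᵢ≡0 l))))
    where
    cancel : ∀ v L → (v - L) + L ≡ v
    cancel = solve-∀

  span-∘tail : ∀ {m k} {c : Fin k → Fin (suc m) → ℤ} {v : Fin (suc m) → ℤ} →
               InSpan c v → InSpan (tail ∘ c) (tail v)
  span-∘tail ⟨ y , v-comb≡0 ⟩ = ⟨ y , v-comb≡0 ∘ suc ⟩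

  span-moveToFront : ∀ {m k} {c : Fin (suc k) → Fin m → ℤ} {v : Fin m → ℤ} (q : Fin (suc k)) →
                     InSpan c v → InSpan (moveToFront c q) v
  span-moveToFront {c = c} {v} q ⟨ y , v-comb≡0 ⟩ =
    ⟨ moveToFront y q , (λ i → subst (λ s → v i - s ≡0) (lincomb-moveToFront q y c i) (v-comb≡0 i)) ⟩

  span-eliminate : ∀ {m k} {c : Fin (suc k) → Fin (suc m) → ℤ} {v : Fin (suc m) → ℤ} →
                   InSpan c v → v zero ≡0 →
                   InSpan (tail ∘ eliminate c) (λ i → c zero zero * v (suc i))
  span-eliminate {c = c} {v} ⟨ y , v-comb≡0 ⟩ v₀≡0 = ⟨ tail y , (λ i →
    subst _≡0 (sym (trans (cong (_-_ (b * v (suc i))) (lincomb-tail-eliminate y c (suc i)))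
                          (regroup b (v (suc i)) (lincomb y c (suc i)) (lincomb y c zero) (c zero (suc i)))))
          (∣m∣n⇒∣m+n (∣n⇒∣m*n b (v-comb≡0 (suc i))) (∣m⇒∣m*n (c zero (suc i)) comb₀≡0))) ⟩
    where
    b = c zero zero
    cancel : ∀ v L → v - (v - L) ≡ L
    cancel = solve-∀
    comb₀≡0 : lincomb y c zero ≡0
    comb₀≡0 = subst _≡0 (cancel (v zero) _) (∣m∣n⇒∣m-n v₀≡0 (v-comb≡0 zero))
    regroup : ∀ b v L S w → b * v - (b * L - S * w) ≡ b * (v - L) + S * w
    regroup = solve-∀

  -- The Steinitz exchange lemma, by Gaussian elimination on coordinate zero.

  SelectIndependent : ℕ → Set
  SelectIndependent m =
    ∀ {k r} (c : Fin k → Fin m → ℤ) (u : Fin r → Fin m → ℤ) →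
    Independent u → (∀ t → InSpan c (u t)) →
    Σ (Fin r → Fin k) λ f → Injective _≡_ _≡_ f × Independent (c ∘ f)

  select-pivoted : ∀ {m k r} (c : Fin (suc k) → Fin (suc m) → ℤ) → ¬ c zero zero ≡0 →
                   SelectIndependent m →
                   (w : Fin r → Fin (suc m) → ℤ) → (∀ t → w t zero ≡0) → Independent (tail ∘ w) →
                   (∀ t → InSpan c (w t)) →
                   Σ (Fin r → Fin k) λ g → Injective _≡_ _≡_ g × Independent (c zero ∷ (tail c ∘ g))
  select-pivoted c b≢0 select w w₀≡0 indep spanned =
    let (g , g-injective , g-independent) =
          select (tail ∘ eliminate c) (λ t i → c zero zero * w t (suc i))
                 (independent-scale (tail ∘ w) b≢0 indep)
                 (λ t → span-eliminate (spanned t) (w₀≡0 t))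
    in g , g-injective , independent-eliminate⁻¹ (c zero ∷ (tail c ∘ g)) b≢0 g-independent

  ∷-punchIn-injective : ∀ {r k} (q : Fin (suc k)) (g : Fin r → Fin k) →
                        Injective _≡_ _≡_ g → Injective _≡_ _≡_ (q ∷ (punchIn q ∘ g))
  ∷-punchIn-injective q g g-injective {zero}  {zero}  _  = refl
  ∷-punchIn-injective q g g-injective {zero}  {suc t} eq = ⊥-elim (punchInᵢ≢i q (g t) (sym eq))
  ∷-punchIn-injective q g g-injective {suc s} {zero}  eq = ⊥-elim (punchInᵢ≢i q (g s) eq)
  ∷-punchIn-injective q g g-injective {suc s} {suc t} eq =
    cong suc (g-injective (punchIn-injective q (g s) (g t) eq))

  -- Coordinate zero of u j is nonzero: clearing it from the other r - 1 vectors leaves a family to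
  -- reduce against the pivot c q, and q itself joins the selection.
  select-eliminating : ∀ {m k r} (c : Fin (suc k) → Fin (suc m) → ℤ) (q : Fin (suc k)) →
                       ¬ c q zero ≡0 → SelectIndependent m →
                       (u : Fin r → Fin (suc m) → ℤ) → Independent u → (∀ t → InSpan c (u t)) →
                       Σ (Fin r) (λ j → ¬ u j zero ≡0) →
                       Σ (Fin r → Fin (suc k)) λ f → Injective _≡_ _≡_ f × Independent (c ∘ f)
  select-eliminating {r = zero}  c q cq≢0 select u indep spanned (() , _)
  select-eliminating {r = suc r} c q cq≢0 select u indep spanned (j , uj≢0) =
    let u′ = moveToFront u j
        (g , g-injective , g-independent) =
          select-pivoted (moveToFront c q) cq≢0 select (eliminate u′) (eliminate-zero u′)
            (independent-eliminate u′ uj≢0 (independent-moveToFront u j indep))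
            (λ t → span-linear (u j zero) (u (punchIn j t) zero)
                     (span-moveToFront q (spanned (punchIn j t))) (span-moveToFront q (spanned j)))
    in q ∷ (punchIn q ∘ g) , ∷-punchIn-injective q g g-injective , g-independent

  select-with-pivot : ∀ {m k r} (c : Fin k → Fin (suc m) → ℤ) → SelectIndependent m →
                      (u : Fin r → Fin (suc m) → ℤ) → Independent u → (∀ t → InSpan c (u t)) →
                      Σ (Fin k) (λ q → ¬ c q zero ≡0) →
                      Σ (Fin r → Fin k) λ f → Injective _≡_ _≡_ f × Independent (c ∘ f)
  select-with-pivot {k = zero}  c select u indep spanned (() , _)
  select-with-pivot {k = suc k} c select u indep spanned (q , cq≢0) with all? (λ t → u t zero ≡0?)
  ... | yes u₀≡0 =
    let (g , g-injective , g-independent) =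
          select-pivoted (moveToFront c q) cq≢0 select u u₀≡0 (independent-∘tail u u₀≡0 indep)
            (λ t → span-moveToFront q (spanned t))
    in punchIn q ∘ g , (λ eq → g-injective (punchIn-injective q _ _ eq)) ,
       independent-tail (c q ∷ (removeAt c q ∘ g)) g-independent
  ... | no ¬u₀≡0 =
    select-eliminating c q cq≢0 select u indep spanned (¬∀⟶∃¬ _ _ (λ t → u t zero ≡0?) ¬u₀≡0)

  select-independent : ∀ m → SelectIndependent m
  select-independent zero {r = zero}  c u _     _ = (λ ()) , (λ { {()} }) , (λ _ _ ())
  select-independent zero {r = suc r} c u indep _ = ⊥-elim (¬1≡0 (indep (λ _ → 1ℤ) (λ ()) zero))
  select-independent (suc m) {k} c u indep spanned with all? (λ l → c l zero ≡0?)
  ... | yes c₀≡0 =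
    let (f , f-injective , f-independent) =
          select-independent m (tail ∘ c) (tail ∘ u)
            (independent-∘tail u (λ t → span-coordinate zero c₀≡0 (spanned t)) indep)
            (λ t → span-∘tail (spanned t))
    in f , f-injective , independent-∘tail⁻¹ (c ∘ f) f-independent
  ... | no ¬c₀≡0 = select-with-pivot c (select-independent m) u indep spanned
                     (¬∀⟶∃¬ k _ (λ l → c l zero ≡0?) ¬c₀≡0)

  module _ {n} (A : Matrix n n) (λ₀ : ℤ) where

    shiftedWalk : ℕ → Fin n → ℤ
    shiftedWalk t i = walkVec A (suc t) i - λ₀ * walkVec A t i

    walkGenerators : ∀ {K} → Fin (suc K) → Fin n → ℤ
    walkGenerators zero    = walkVec A 0
    walkGenerators (suc l) = shiftedWalk (toℕ l)

    walk-in-span : ∀ {K} t → t ≤ K → InSpan (walkGenerators {K}) (walkVec A t)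
    walk-in-span zero    _   = span-generator walkGenerators zero
    walk-in-span (suc t) t<K =
      span-cong (λ i → step λ₀ (walkVec A (suc t) i) (walkVec A t i))
        (span-linear 1ℤ (- λ₀) shifted-in-span (walk-in-span t (<⇒≤ t<K)))
      where
      shifted-in-span : InSpan walkGenerators (shiftedWalk t)
      shifted-in-span = subst (λ s → InSpan walkGenerators (shiftedWalk s)) (toℕ-fromℕ< t<K)
                              (span-generator walkGenerators (suc (fromℕ< t<K)))
      step : ∀ a w w′ → 1ℤ * (w - a * w′) - (- a) * w′ ≡ w
      step = solve-∀

    lincomb-shift : ∀ (v : Fin n → ℤ) i →
                    lincomb v (column (shiftMatrix A λ₀)) i ≡ mulVec A v i - λ₀ * v i
    lincomb-shift v i = begin
      sumFin n (λ j → v j * (A i j - δ j))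
        ≡⟨ sumFin-cong n (λ j → expand (v j) (A i j) (δ j)) ⟩
      sumFin n (λ j → 1ℤ * (A i j * v j) + (- 1ℤ) * (δ j * v j))
        ≡⟨ sumFin-linear n 1ℤ (- 1ℤ) (λ j → A i j * v j) (λ j → δ j * v j) ⟩
      1ℤ * mulVec A v i + (- 1ℤ) * sumFin n (λ j → δ j * v j)
        ≡⟨ cong (λ s → 1ℤ * mulVec A v i + (- 1ℤ) * s) (sumFin-diagonal i λ₀ v) ⟩
      1ℤ * mulVec A v i + (- 1ℤ) * (λ₀ * v i)
        ≡⟨ simplify (mulVec A v i) (λ₀ * v i) ⟩
      mulVec A v i - λ₀ * v i ∎
      where
      open ≡-Reasoning
      δ : Fin n → ℤ
      δ j = if does (i ≟ j) then λ₀ else 0ℤ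
      expand : ∀ v a d → v * (a - d) ≡ 1ℤ * (a * v) + (- 1ℤ) * (d * v)
      expand = solve-∀
      simplify : ∀ a b → 1ℤ * a + (- 1ℤ) * b ≡ a - b
      simplify = solve-∀

    generator-in-shift-span : ∀ {K} (l : Fin (suc K)) → l ≢ zero →
                              InSpan (column (shiftMatrix A λ₀)) (walkGenerators l)
    generator-in-shift-span zero    l≢0 = ⊥-elim (l≢0 refl)
    generator-in-shift-span (suc l) _   =
      span-exact (walkVec A (toℕ l)) (lincomb-shift (walkVec A (toℕ l)))

  walkRank⇒shiftRank : ∀ {N} (A : Matrix (suc (suc N)) (suc (suc N))) (λ₀ : ℤ) →
                       RankGe p (walkMatrix A) (suc N) → RankGe p (shiftMatrix A λ₀) N
  walkRank⇒shiftRank A λ₀ (f , _ , f-independent) =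
    let (g , g-injective , g-independent) =
          select-independent _ (walkGenerators A λ₀) (column (walkMatrix A) ∘ f)
            (colsIndepMod⇒independent (walkMatrix A) f f-independent)
            (λ t → walk-in-span A λ₀ (toℕ (f t)) (toℕ≤pred[n] (f t)))
        (i₀ , avoids-zero) = avoid-zero g g-injective
        (h , h-injective , h-independent) =
          select-independent _ (column (shiftMatrix A λ₀)) (removeAt (walkGenerators A λ₀ ∘ g) i₀)
            (independent-removeAt (walkGenerators A λ₀ ∘ g) i₀ g-independent)
            (λ t → generator-in-shift-span A λ₀ (g (punchIn i₀ t)) (avoids-zero t))
    in h , h-injective , independent⇒colsIndepMod (shiftMatrix A λ₀) h h-independent

rankGe-zero : ∀ {m k} p (M : Matrix m k) → RankGe p M 0
rankGe-zero p M = (λ ()) , (λ { {()} }) , (λ _ _ ())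

lemma3p5 : (n : ℕ) (G : SimpleGraph n) (p : ℕ) → Prime p →
           RankEq p (walkMatrix (adjMatrix G)) (n ∸ 1) →
           (λ₀ : ℤ) → RankGe p (shiftMatrix (adjMatrix G) λ₀) (n ∸ 2)
lemma3p5 zero          G p _ _              λ₀ = rankGe-zero p (shiftMatrix (adjMatrix G) λ₀)
lemma3p5 (suc zero)    G p _ _              λ₀ = rankGe-zero p (shiftMatrix (adjMatrix G) λ₀)
lemma3p5 (suc (suc n)) G p p-prime (walkRank , _) λ₀ =
  walkRank⇒shiftRank p p-prime (adjMatrix G) λ₀ walkRank
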